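{- Let $\mathbf X$ be a strictly $\mathcal M$-adhesive category with all pullbacks. Consider a commutative cube with top face $f'\colon A'\to B'$, $m'\colon A'\to C'$, $n'\colon B'\to D'$, $g'\colon C'\to D'$ with $m',n'\in\mathcal M$, bottom face $f\colon A\to B$, $m\colon A\to C$, $n\colon B\to D$, $g\colon C\to D$, and vertical arrows $a\colon A'\to A$, $b\colon B'\to B$, $c\colon C'\to C$, $d\colon D'\to D$. Suppose that the top face is a pushout (along $m'\in\mathcal M$) and all four vertical faces are pullbacks. Let $(K_x,\pi^1_x,\pi^2_x)$ be kernel pairs of $x\in\{a,b,c,d\}$, and let $k_{f'}\colon K_a\to K_b$, $k_{m'}\colon K_a\to K_c$, $k_{n'}\colon K_b\to K_d$, $k_{g'}\colon K_c\to K_d$ be the unique arrows commuting with the kernel-pair projections (e.g. $\pi^i_b\circ k_{f'}=f'\circ\pi^i_a$ for $i=1,2$). Then the square formed by $k_{f'},k_{m'},k_{n'},k_{g'}$ is a pushout.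
   Context: A kernel pair of an arrow $x\colon X\to Y$ is a pullback $(K_x,\pi^1_x,\pi^2_x)$ of $x$ along itself. Let $\mathcal M$ be a class of monomorphisms of $\mathbf X$ containing all isomorphisms, closed under composition, closed under decomposition (if $g\in\mathcal M$ and $g\circ f\in\mathcal M$ then $f\in\mathcal M$), and stable under pullbacks and pushouts. For a commutative cube with top vertices $A',B',C',D'$ over bottom vertices $A,B,C,D$, call the face on $A',B',A,B$ back, on $A',C',A,C$ left, on $C',D',C,D$ front, on $B',D',B,D$ right. A pushout square (the bottom face) is Van Kampen if for every commutative cube over it whose back and left faces are pullbacks, the top face is a pushout iff the front and right faces are pullbacks. $\mathbf X$ is strictly $\mathcal M$-adhesive if it has pullbacks along arrows of $\mathcal M$, pushouts along arrows of $\mathcal M$, and every pushout along an arrow of $\mathcal M$ is Van Kampen. The induced arrows between kernel pairs exist uniquely because the cube commutes. -}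

module Defs where

open import Level using (Level; _⊔_; suc)
open import Data.Product using (Σ; _×_; _,_)
open import Data.Sum using (_⊎_)
open import Relation.Binary.PropositionalEquality using (_≡_)

record Category (o ℓ : Level) : Set (suc (o ⊔ ℓ)) where
  infixr 9 _∘_
  field
    Obj  : Set o
    Hom  : Obj → Obj → Set ℓ
    id   : ∀ {A} → Hom A A
    _∘_  : ∀ {A B C} → Hom B C → Hom A B → Hom A C
    identityˡ : ∀ {A B} (f : Hom A B) → id ∘ f ≡ f
    identityʳ : ∀ {A B} (f : Hom A B) → f ∘ id ≡ f
    assoc : ∀ {A B C D} (f : Hom A B) (g : Hom B C) (h : Hom C D) →
            (h ∘ g) ∘ f ≡ h ∘ (g ∘ f)

module _ {o ℓ} (𝒞 : Category o ℓ) where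
  open Category 𝒞

  IsMono : ∀ {A B} → Hom A B → Set (o ⊔ ℓ)
  IsMono {A} f = ∀ {X} (g h : Hom X A) → f ∘ g ≡ f ∘ h → g ≡ h

  IsIso : ∀ {A B} → Hom A B → Set ℓ
  IsIso {A} {B} f = Σ (Hom B A) λ g → (g ∘ f ≡ id) × (f ∘ g ≡ id)

  IsPullback : ∀ {P A B C} (f : Hom A C) (g : Hom B C) (p : Hom P A) (q : Hom P B) →
               Set (o ⊔ ℓ)
  IsPullback {P} {A} {B} f g p q =
    (f ∘ p ≡ g ∘ q) ×
    (∀ {X} (h : Hom X A) (k : Hom X B) → f ∘ h ≡ g ∘ k →
      Σ (Hom X P) λ u → (p ∘ u ≡ h) × (q ∘ u ≡ k) ×
        (∀ (u' : Hom X P) → p ∘ u' ≡ h → q ∘ u' ≡ k → u' ≡ u))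

  IsPushout : ∀ {A B C D} (f : Hom A B) (g : Hom A C) (i : Hom B D) (j : Hom C D) →
              Set (o ⊔ ℓ)
  IsPushout {A} {B} {C} {D} f g i j =
    (i ∘ f ≡ j ∘ g) ×
    (∀ {X} (h : Hom B X) (k : Hom C X) → h ∘ f ≡ k ∘ g →
      Σ (Hom D X) λ u → (u ∘ i ≡ h) × (u ∘ j ≡ k) ×
        (∀ (u' : Hom D X) → u' ∘ i ≡ h → u' ∘ j ≡ k → u' ≡ u))

  record Cube {A B C D : Obj} (f : Hom A B) (m : Hom A C) (n : Hom B D) (g : Hom C D)
              : Set (o ⊔ ℓ) where
    field
      A' B' C' D' : Obj
      f' : Hom A' B'
      m' : Hom A' C'
      n' : Hom B' D'
      g' : Hom C' D'
      a  : Hom A' A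
      b  : Hom B' B
      c  : Hom C' C
      d  : Hom D' D
      top-comm   : n' ∘ f' ≡ g' ∘ m'
      back-comm  : b ∘ f' ≡ f ∘ a
      left-comm  : c ∘ m' ≡ m ∘ a
      front-comm : d ∘ g' ≡ g ∘ c
      right-comm : d ∘ n' ≡ n ∘ b

    Back  = IsPullback f b a f'
    Left  = IsPullback m c a m'
    Front = IsPullback g d c g'
    Right = IsPullback n d b n'
    Top   = IsPushout f' m' n' g'

  IsVanKampen : ∀ {A B C D} (f : Hom A B) (m : Hom A C) (n : Hom B D) (g : Hom C D) →
                Set (o ⊔ ℓ)
  IsVanKampen f m n g =
    ∀ (K : Cube f m n g) → let open Cube K in
      Back → Left → ((Top → Front × Right) × (Front × Right → Top))

  record MonoClass (ℓm : Level) : Set (o ⊔ ℓ ⊔ suc ℓm) where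
    field
      𝓜 : ∀ {A B} → Hom A B → Set ℓm
      mono      : ∀ {A B} (f : Hom A B) → 𝓜 f → IsMono f
      iso       : ∀ {A B} (f : Hom A B) → IsIso f → 𝓜 f
      comp      : ∀ {A B C} (f : Hom A B) (g : Hom B C) → 𝓜 f → 𝓜 g → 𝓜 (g ∘ f)
      decomp    : ∀ {A B C} (f : Hom A B) (g : Hom B C) → 𝓜 g → 𝓜 (g ∘ f) → 𝓜 f
      pb-stable : ∀ {P A B C} (f : Hom A C) (g : Hom B C) (p : Hom P A) (q : Hom P B) →
                  IsPullback f g p q → 𝓜 g → 𝓜 p
      po-stable : ∀ {A B C D} (f : Hom A B) (g : Hom A C) (i : Hom B D) (j : Hom C D) →
                  IsPushout f g i j → 𝓜 f → 𝓜 j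

  HasPullbacks : Set (o ⊔ ℓ)
  HasPullbacks = ∀ {A B C} (f : Hom A C) (g : Hom B C) →
    Σ Obj λ P → Σ (Hom P A) λ p → Σ (Hom P B) λ q → IsPullback f g p q

  record StrictlyAdhesive {ℓm} (M : MonoClass ℓm) : Set (o ⊔ ℓ ⊔ ℓm) where
    open MonoClass M
    field
      pullback-along : ∀ {A B C} (f : Hom A C) (g : Hom B C) → 𝓜 g →
        Σ Obj λ P → Σ (Hom P A) λ p → Σ (Hom P B) λ q → IsPullback f g p q
      pushout-along : ∀ {A B C} (f : Hom A B) (g : Hom A C) → 𝓜 f →
        Σ Obj λ D → Σ (Hom B D) λ i → Σ (Hom C D) λ j → IsPushout f g i j
      vk : ∀ {A B C D} (f : Hom A B) (m : Hom A C) (n : Hom B D) (g : Hom C D) →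
           IsPushout f m n g → 𝓜 f ⊎ 𝓜 m → IsVanKampen f m n g

  record KernelPair {X Y : Obj} (x : Hom X Y) : Set (o ⊔ ℓ) where
    field
      K  : Obj
      π₁ : Hom K X
      π₂ : Hom K X
      isPullback : IsPullback x x π₁ π₂

{-# OPTIONS --safe #-}
module Submission where

-- The kernel pairs, with their first projections, form a cube over the top
-- face whose vertical faces are pullbacks: pasting the back face A' → A over
-- B' → B with the kernel-pair square of a gives a pullback which factors
-- through the kernel-pair square of b, so K_a ≅ A' ×_{B'} K_b, and likewise
-- for the other three faces. The top face is a pushout along m' ∈ 𝓜, hence
-- Van Kampen, so the top of this new cube is a pushout.

open import Defs
open import Level using (Level)
open import Data.Product using (_×_; _,_; proj₁; proj₂)
open import Data.Sum using (inj₂)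
open import Relation.Binary.PropositionalEquality
  using (_≡_; refl; sym; trans; cong; subst₂; module ≡-Reasoning)

module CategoryProperties {o ℓ} (𝒞 : Category o ℓ) where
  open Category 𝒞
  open ≡-Reasoning
  open KernelPair

  private
    variable
      P Q X A B C E P′ X₀ Y Y₀ Z Z₀ : Obj

  ∘-assoc : {f : Hom A B} {g : Hom B C} {h : Hom C E} → (h ∘ g) ∘ f ≡ h ∘ (g ∘ f)
  ∘-assoc {f = f} {g} {h} = assoc f g h

  pullʳ : {f : Hom A B} {g : Hom B C} {h : Hom C E} {k : Hom A C} →
          g ∘ f ≡ k → (h ∘ g) ∘ f ≡ h ∘ k
  pullʳ {h = h} e = trans ∘-assoc (cong (h ∘_) e)

  pullˡ : {f : Hom A B} {g : Hom B C} {h : Hom C E} {k : Hom B E} →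
          h ∘ g ≡ k → h ∘ (g ∘ f) ≡ k ∘ f
  pullˡ {f = f} e = trans (sym ∘-assoc) (cong (_∘ f) e)

  extendʳ : {f : Hom A E} {g : Hom B E} {p : Hom C A} {q : Hom C B} {y : Hom X C} →
            f ∘ p ≡ g ∘ q → f ∘ (p ∘ y) ≡ g ∘ (q ∘ y)
  extendʳ e = trans (pullˡ e) ∘-assoc

  glue : {p : Hom P Y} {k : Hom Q P} {h : Hom X Y} {p′ : Hom Q X}
         {k′ : Hom P′ Q} {h′ : Hom Z X} {p″ : Hom P′ Z} →
         p ∘ k ≡ h ∘ p′ → p′ ∘ k′ ≡ h′ ∘ p″ → p ∘ (k ∘ k′) ≡ (h ∘ h′) ∘ p″
  glue e e′ = trans (pullˡ e) (trans (pullʳ e′) (sym ∘-assoc))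

  module Pullback {f : Hom A C} {g : Hom B C} {p : Hom P A} {q : Hom P B}
                  (pb : IsPullback 𝒞 f g p q) where

    commutes : f ∘ p ≡ g ∘ q
    commutes = proj₁ pb

    module _ {h : Hom X A} {k : Hom X B} (e : f ∘ h ≡ g ∘ k) where

      universal : Hom X P
      universal = proj₁ (proj₂ pb h k e)

      p∘universal : p ∘ universal ≡ h
      p∘universal = proj₁ (proj₂ (proj₂ pb h k e))

      q∘universal : q ∘ universal ≡ k
      q∘universal = proj₁ (proj₂ (proj₂ (proj₂ pb h k e)))

      unique : {u : Hom X P} → p ∘ u ≡ h → q ∘ u ≡ k → u ≡ universal
      unique {u} = proj₂ (proj₂ (proj₂ (proj₂ pb h k e))) u

    jointly-monic : {x y : Hom X P} → p ∘ x ≡ p ∘ y → q ∘ x ≡ q ∘ y → x ≡ y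
    jointly-monic {y = y} ep eq = trans (unique e ep eq) (sym (unique e refl refl))
      where
      e : f ∘ (p ∘ y) ≡ g ∘ (q ∘ y)
      e = extendʳ commutes

  mkPullback : {f : Hom A C} {g : Hom B C} {p : Hom P A} {q : Hom P B} →
    f ∘ p ≡ g ∘ q →
    (universal : ∀ {X} {h : Hom X A} {k : Hom X B} → f ∘ h ≡ g ∘ k → Hom X P) →
    (∀ {X} {h : Hom X A} {k : Hom X B} (e : f ∘ h ≡ g ∘ k) → p ∘ universal e ≡ h) →
    (∀ {X} {h : Hom X A} {k : Hom X B} (e : f ∘ h ≡ g ∘ k) → q ∘ universal e ≡ k) →
    (∀ {X} {h : Hom X A} {k : Hom X B} (e : f ∘ h ≡ g ∘ k) (u : Hom X P) →
       p ∘ u ≡ h → q ∘ u ≡ k → u ≡ universal e) →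
    IsPullback 𝒞 f g p q
  mkPullback commutes universal p∘universal q∘universal unique =
    commutes , λ h k e → universal e , p∘universal e , q∘universal e , unique e

  module _ {f₁ : Hom A E} {f₂ : Hom E C} {g : Hom B C} {r : Hom Q E} {q₂ : Hom Q B}
           {p : Hom P A} {q₁ : Hom P Q} (right : IsPullback 𝒞 f₂ g r q₂) where
    private
      module R = Pullback right

    pullback-paste : IsPullback 𝒞 f₁ r p q₁ → IsPullback 𝒞 (f₂ ∘ f₁) g p (q₂ ∘ q₁)
    pullback-paste left = mkPullback square universal p∘universal q∘universal unique
      where
      module L = Pullback left

      square : (f₂ ∘ f₁) ∘ p ≡ g ∘ (q₂ ∘ q₁)
      square = begin
        (f₂ ∘ f₁) ∘ p  ≡⟨ pullʳ L.commutes ⟩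
        f₂ ∘ (r ∘ q₁)  ≡⟨ pullˡ R.commutes ⟩
        (g ∘ q₂) ∘ q₁  ≡⟨ ∘-assoc ⟩
        g ∘ (q₂ ∘ q₁)  ∎

      module _ {h : Hom X A} {k : Hom X B} (e : (f₂ ∘ f₁) ∘ h ≡ g ∘ k) where

        right-cone : f₂ ∘ (f₁ ∘ h) ≡ g ∘ k
        right-cone = trans (sym ∘-assoc) e

        left-cone : f₁ ∘ h ≡ r ∘ R.universal right-cone
        left-cone = sym (R.p∘universal right-cone)

        universal : Hom X P
        universal = L.universal left-cone

        p∘universal : p ∘ universal ≡ h
        p∘universal = L.p∘universal left-cone

        q∘universal : (q₂ ∘ q₁) ∘ universal ≡ k
        q∘universal = trans (pullʳ (L.q∘universal left-cone)) (R.q∘universal right-cone)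

        unique : (u : Hom X P) → p ∘ u ≡ h → (q₂ ∘ q₁) ∘ u ≡ k → u ≡ universal
        unique u pu qu = L.unique left-cone pu
          (R.unique right-cone (trans (pullˡ (sym L.commutes)) (pullʳ pu)) (trans (sym ∘-assoc) qu))

    pullback-unpaste : f₁ ∘ p ≡ r ∘ q₁ → IsPullback 𝒞 (f₂ ∘ f₁) g p (q₂ ∘ q₁) →
                       IsPullback 𝒞 f₁ r p q₁
    pullback-unpaste square outer = mkPullback square universal p∘universal q∘universal unique
      where
      module O = Pullback outer

      module _ {h : Hom X A} {k : Hom X Q} (e : f₁ ∘ h ≡ r ∘ k) where

        outer-cone : (f₂ ∘ f₁) ∘ h ≡ g ∘ (q₂ ∘ k)
        outer-cone = trans (pullʳ e) (extendʳ R.commutes)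

        universal : Hom X P
        universal = O.universal outer-cone

        p∘universal : p ∘ universal ≡ h
        p∘universal = O.p∘universal outer-cone

        q∘universal : q₁ ∘ universal ≡ k
        q∘universal = R.jointly-monic
          (trans (pullˡ (sym square)) (trans (pullʳ p∘universal) e))
          (trans (sym ∘-assoc) (O.q∘universal outer-cone))

        unique : (u : Hom X P) → p ∘ u ≡ h → q₁ ∘ u ≡ k → u ≡ universal
        unique u pu qu = O.unique outer-cone pu (trans ∘-assoc (cong (q₂ ∘_) qu))

  IsKernelPairMap : {x : Hom X X₀} {y : Hom Y Y₀} (Kx : KernelPair 𝒞 x) (Ky : KernelPair 𝒞 y) →
                    Hom X Y → Hom (K Kx) (K Ky) → Set ℓ
  IsKernelPairMap Kx Ky h k = (π₁ Ky ∘ k ≡ h ∘ π₁ Kx) × (π₂ Ky ∘ k ≡ h ∘ π₂ Kx)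

  module _ {x : Hom X X₀} {y : Hom Y Y₀} (Kx : KernelPair 𝒞 x) (Ky : KernelPair 𝒞 y) where

    kernelPairMap-∘ : {z : Hom Z Z₀} (Kz : KernelPair 𝒞 z) {h : Hom Y Z} {h′ : Hom X Y}
                      {k : Hom (K Ky) (K Kz)} {k′ : Hom (K Kx) (K Ky)} →
                      IsKernelPairMap Ky Kz h k → IsKernelPairMap Kx Ky h′ k′ →
                      IsKernelPairMap Kx Kz (h ∘ h′) (k ∘ k′)
    kernelPairMap-∘ _ (k₁ , k₂) (k₁′ , k₂′) = glue k₁ k₁′ , glue k₂ k₂′

    kernelPairMap-unique : {h h′ : Hom X Y} {k k′ : Hom (K Kx) (K Ky)} → h ≡ h′ →
                           IsKernelPairMap Kx Ky h k → IsKernelPairMap Kx Ky h′ k′ → k ≡ k′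
    kernelPairMap-unique refl (k₁ , k₂) (k₁′ , k₂′) =
      Pullback.jointly-monic (isPullback Ky) (trans k₁ (sym k₁′)) (trans k₂ (sym k₂′))

    kernelPair-pullback : {h : Hom X Y} {h₀ : Hom X₀ Y₀} {k : Hom (K Kx) (K Ky)} →
                          IsPullback 𝒞 h₀ y x h → IsKernelPairMap Kx Ky h k →
                          IsPullback 𝒞 h (π₁ Ky) (π₁ Kx) k
    kernelPair-pullback {h = h} {k = k} pb (k₁ , k₂) =
      pullback-unpaste (isPullback Ky) (sym k₁) outer
      where
      outer : IsPullback 𝒞 (y ∘ h) y (π₁ Kx) (π₂ Ky ∘ k)
      outer = subst₂ (λ s t → IsPullback 𝒞 s y (π₁ Kx) t)
                     (Pullback.commutes pb) (sym k₂) (pullback-paste pb (isPullback Kx))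

proposition2p13 : ∀ {o ℓ ℓm : Level} (𝒞 : Category o ℓ) (M : MonoClass 𝒞 ℓm) →
    StrictlyAdhesive 𝒞 M → HasPullbacks 𝒞 →
    let open Category 𝒞 in
    let open MonoClass M in
    ∀ {A B C D A' B' C' D' : Obj}
      (f : Hom A B) (m : Hom A C) (n : Hom B D) (g : Hom C D)
      (f' : Hom A' B') (m' : Hom A' C') (n' : Hom B' D') (g' : Hom C' D')
      (a : Hom A' A) (b : Hom B' B) (c : Hom C' C) (d : Hom D' D) →
    𝓜 m' → 𝓜 n' →
    n ∘ f ≡ g ∘ m →
    b ∘ f' ≡ f ∘ a → c ∘ m' ≡ m ∘ a → d ∘ g' ≡ g ∘ c → d ∘ n' ≡ n ∘ b →
    IsPushout 𝒞 f' m' n' g' →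
    IsPullback 𝒞 f b a f' → IsPullback 𝒞 m c a m' →
    IsPullback 𝒞 g d c g' → IsPullback 𝒞 n d b n' →
    (Ka : KernelPair 𝒞 a) (Kb : KernelPair 𝒞 b)
    (Kc : KernelPair 𝒞 c) (Kd : KernelPair 𝒞 d) →
    (kf' : Hom (KernelPair.K Ka) (KernelPair.K Kb)) →
    (km' : Hom (KernelPair.K Ka) (KernelPair.K Kc)) →
    (kn' : Hom (KernelPair.K Kb) (KernelPair.K Kd)) →
    (kg' : Hom (KernelPair.K Kc) (KernelPair.K Kd)) →
    (KernelPair.π₁ Kb ∘ kf' ≡ f' ∘ KernelPair.π₁ Ka) × (KernelPair.π₂ Kb ∘ kf' ≡ f' ∘ KernelPair.π₂ Ka) →
    (KernelPair.π₁ Kc ∘ km' ≡ m' ∘ KernelPair.π₁ Ka) × (KernelPair.π₂ Kc ∘ km' ≡ m' ∘ KernelPair.π₂ Ka) →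
    (KernelPair.π₁ Kd ∘ kn' ≡ n' ∘ KernelPair.π₁ Kb) × (KernelPair.π₂ Kd ∘ kn' ≡ n' ∘ KernelPair.π₂ Kb) →
    (KernelPair.π₁ Kd ∘ kg' ≡ g' ∘ KernelPair.π₁ Kc) × (KernelPair.π₂ Kd ∘ kg' ≡ g' ∘ KernelPair.π₂ Kc) →
    IsPushout 𝒞 kf' km' kn' kg'
proposition2p13 𝒞 M adhesive _ f m n g f' m' n' g' a b c d m'∈𝓜 _ _ _ _ _ _
                top back left front right Ka Kb Kc Kd kf' km' kn' kg' kf'-π km'-π kn'-π kg'-π =
  proj₂ (vk f' m' n' g' top (inj₂ m'∈𝓜) kernelPairCube
          (kernelPair-pullback Ka Kb back kf'-π) (kernelPair-pullback Ka Kc left km'-π))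
        (kernelPair-pullback Kc Kd front kg'-π , kernelPair-pullback Kb Kd right kn'-π)
  where
  open Category 𝒞
  open CategoryProperties 𝒞
  open StrictlyAdhesive adhesive using (vk)
  open KernelPair using (π₁)

  kernelPairCube : Cube 𝒞 f' m' n' g'
  kernelPairCube = record
    { f' = kf' ; m' = km' ; n' = kn' ; g' = kg'
    ; a = π₁ Ka ; b = π₁ Kb ; c = π₁ Kc ; d = π₁ Kd
    ; top-comm = kernelPairMap-unique Ka Kd (proj₁ top)
                   (kernelPairMap-∘ Ka Kb Kd kn'-π kf'-π) (kernelPairMap-∘ Ka Kc Kd kg'-π km'-π)
    ; back-comm = proj₁ kf'-π ; left-comm = proj₁ km'-π
    ; front-comm = proj₁ kg'-π ; right-comm = proj₁ kn'-π
    }
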